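{- (1) If $x\in\mathcal V_A$ and $x:B$, then $A\equiv B$. (2) If $\lambda x^A.r:B$, then there is a type $C$ with $B\equiv A\Rightarrow C$ and $r:C$. (3) If $rs:B$, then there is a type $A$ with $r:A\Rightarrow B$ and $s:A$. (4) If $r\times s:A$, then there are types $B,C$ with $A\equiv B\wedge C$, $r:B$ and $s:C$. (5) If $\pi_A(r):B$, then $A\equiv B$ and there is a type $C$ with $r:B\wedge C$.
   Context: Types are generated by $A ::= \tau \mid A\Rightarrow A \mid A\wedge A$, where $\tau$ is the only atomic type ($\Rightarrow$ associates to the right). Type equivalence $\equiv$ is the smallest congruence on types such that $A\wedge B\equiv B\wedge A$, $A\wedge(B\wedge C)\equiv(A\wedge B)\wedge C$, $A\Rightarrow(B\wedge C)\equiv(A\Rightarrow B)\wedge(A\Rightarrow C)$ and $(A\wedge B)\Rightarrow C\equiv A\Rightarrow B\Rightarrow C$. To each type $A$ is associated an infinite set of variables $\mathcal V_A$, with $\mathcal V_A=\mathcal V_B$ if $A\equiv B$ and $\mathcal V_A\cap\mathcal V_B=\emptyset$ otherwise. Preterms are $r ::= x \mid \lambda x.r \mid rr \mid r\times r \mid \pi_A(r)$; one writes $\lambda x^A.r$ for $\lambda x.r$ when $x\in\mathcal V_A$. The typing judgement $r:A$ (without contexts) is given by: $x:A$ if $x\in\mathcal V_A$; if $r:A$ and $A\equiv B$ then $r:B$; if $r:B$ then $\lambda x^A.r:A\Rightarrow B$; if $r:A\Rightarrow B$ and $s:A$ then $rs:B$; if $r:A$ and $s:B$ then $r\times s:A\wedge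 B$; if $r:A\wedge B$ then $\pi_A(r):A$. -}

module Defs where

open import Data.Nat using (ℕ)
open import Data.Product using (Σ; ∃; ∃-syntax; _×_; _,_)
open import Relation.Binary.PropositionalEquality using (_≡_)
open import Function.Definitions using (Injective)

infixr 7 _⇒_
infixr 8 _∧_
infix 4 _≡ₜ_

data Ty : Set where
  τ   : Ty
  _⇒_ : Ty → Ty → Ty
  _∧_ : Ty → Ty → Ty

data _≡ₜ_ : Ty → Ty → Set where
  ≡-refl  : ∀ {A} → A ≡ₜ A
  ≡-sym   : ∀ {A B} → A ≡ₜ B → B ≡ₜ A
  ≡-trans : ∀ {A B C} → A ≡ₜ B → B ≡ₜ C → A ≡ₜ C
  ≡-cong⇒ : ∀ {A A' B B'} → A ≡ₜ A' → B ≡ₜ B' → A ⇒ B ≡ₜ A' ⇒ B'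
  ≡-cong∧ : ∀ {A A' B B'} → A ≡ₜ A' → B ≡ₜ B' → A ∧ B ≡ₜ A' ∧ B'
  ≡-comm  : ∀ {A B} → A ∧ B ≡ₜ B ∧ A
  ≡-assoc : ∀ {A B C} → A ∧ (B ∧ C) ≡ₜ (A ∧ B) ∧ C
  ≡-distr : ∀ {A B C} → A ⇒ (B ∧ C) ≡ₜ (A ⇒ B) ∧ (A ⇒ C)
  ≡-curry : ∀ {A B C} → (A ∧ B) ⇒ C ≡ₜ A ⇒ B ⇒ C

-- A system of typed variables: to each type A an infinite set V_A of
-- variables, with V_A = V_B when A ≡ B and V_A ∩ V_B = ∅ otherwise.
record VarSystem : Set₁ where
  field
    Var      : Set
    _∈V_     : Var → Ty → Set
    ∈V-resp  : ∀ {x A B} → A ≡ₜ B → x ∈V A → x ∈V B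
    ∈V-disj  : ∀ {x A B} → x ∈V A → x ∈V B → A ≡ₜ B
    ∈V-infinite : ∀ A → Σ (ℕ → Var) λ f → Injective _≡_ _≡_ f × (∀ n → f n ∈V A)

module Terms (𝒱 : VarSystem) where
  open VarSystem 𝒱

  data Term : Set where
    var  : Var → Term
    lam  : Var → Term → Term
    app  : Term → Term → Term
    pair : Term → Term → Term
    proj : Ty → Term → Term

  infix 3 _∶_
  data _∶_ : Term → Ty → Set where
    ty-var  : ∀ {x A} → x ∈V A → var x ∶ A
    ty-≡    : ∀ {r A B} → r ∶ A → A ≡ₜ B → r ∶ B
    ty-lam  : ∀ {x r A B} → x ∈V A → r ∶ B → lam x r ∶ A ⇒ B
    ty-app  : ∀ {r s A B} → r ∶ A ⇒ B → s ∶ A → app r s ∶ B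
    ty-pair : ∀ {r s A B} → r ∶ A → s ∶ B → pair r s ∶ A ∧ B
    ty-proj : ∀ {r A B} → r ∶ A ∧ B → proj A r ∶ A

module Submission where

-- The only typing rule not determined by the shape of the term is the
-- conversion rule ty-≡.  Since ≡ₜ is transitive, any stack of conversions
-- at the root of a derivation collapses into a single one.  So we first
-- prove the normal-form lemma  syntaxDirected : every derivation of r ∶ B
-- is a derivation of r ∶ A ending in the syntax-directed rule for the
-- shape of r, together with A ≡ₜ B.  Each of the five generation lemmas
-- then reads off the premises of that last rule and transports its
-- conclusion along A ≡ₜ B, using the congruence rules of ≡ₜ where the
-- type appears inside an arrow or a conjunction.

open import Defs
open import Data.Product using (∃-syntax; _×_; _,_)
open Terms

module Generation (𝒱 : VarSystem) where
  open VarSystem 𝒱 using (_∈V_; ∈V-disj)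

  infix 3 _⦂_ _⦂ˢ_

  _⦂_ : Term 𝒱 → Ty → Set
  _⦂_ = _∶_ 𝒱

  data _⦂ˢ_ : Term 𝒱 → Ty → Set where
    sd-var  : ∀ {x A} → x ∈V A → var x ⦂ˢ A
    sd-lam  : ∀ {x r A B} → x ∈V A → r ⦂ B → lam x r ⦂ˢ A ⇒ B
    sd-app  : ∀ {r s A B} → r ⦂ A ⇒ B → s ⦂ A → app r s ⦂ˢ B
    sd-pair : ∀ {r s A B} → r ⦂ A → s ⦂ B → pair r s ⦂ˢ A ∧ B
    sd-proj : ∀ {r A B} → r ⦂ A ∧ B → proj A r ⦂ˢ A

  syntaxDirected : ∀ {r B} → r ⦂ B → ∃[ A ] (r ⦂ˢ A × A ≡ₜ B)
  syntaxDirected (ty-var x∈A)     = _ , sd-var x∈A , ≡-refl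
  syntaxDirected (ty-lam x∈A r⦂B) = _ , sd-lam x∈A r⦂B , ≡-refl
  syntaxDirected (ty-app r⦂ s⦂)   = _ , sd-app r⦂ s⦂ , ≡-refl
  syntaxDirected (ty-pair r⦂ s⦂)  = _ , sd-pair r⦂ s⦂ , ≡-refl
  syntaxDirected (ty-proj r⦂)     = _ , sd-proj r⦂ , ≡-refl
  syntaxDirected (ty-≡ r⦂ B≡C) with syntaxDirected r⦂
  ... | A , r⦂ˢA , A≡B = A , r⦂ˢA , ≡-trans A≡B B≡C

  varGeneration : ∀ {x A B} → x ∈V A → var x ⦂ B → A ≡ₜ B
  varGeneration x∈A x⦂B with syntaxDirected x⦂B
  ... | _ , sd-var x∈A' , A'≡B = ≡-trans (∈V-disj x∈A x∈A') A'≡B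

  lamGeneration : ∀ {x r A B} → x ∈V A → lam x r ⦂ B
                → ∃[ C ] (B ≡ₜ A ⇒ C × r ⦂ C)
  lamGeneration x∈A λ⦂B with syntaxDirected λ⦂B
  ... | _ , sd-lam x∈A' r⦂C , A'⇒C≡B =
    _ , ≡-trans (≡-sym A'⇒C≡B) (≡-cong⇒ (∈V-disj x∈A' x∈A) ≡-refl) , r⦂C

  appGeneration : ∀ {r s B} → app r s ⦂ B → ∃[ A ] (r ⦂ A ⇒ B × s ⦂ A)
  appGeneration rs⦂B with syntaxDirected rs⦂B
  ... | _ , sd-app r⦂A⇒C s⦂A , C≡B = _ , ty-≡ r⦂A⇒C (≡-cong⇒ ≡-refl C≡B) , s⦂A

  pairGeneration : ∀ {r s A} → pair r s ⦂ A
                 → ∃[ B ] ∃[ C ] (A ≡ₜ B ∧ C × r ⦂ B × s ⦂ C)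
  pairGeneration rs⦂A with syntaxDirected rs⦂A
  ... | _ , sd-pair r⦂B s⦂C , B∧C≡A = _ , _ , ≡-sym B∧C≡A , r⦂B , s⦂C

  projGeneration : ∀ {r A B} → proj A r ⦂ B → A ≡ₜ B × ∃[ C ] (r ⦂ B ∧ C)
  projGeneration πr⦂B with syntaxDirected πr⦂B
  ... | _ , sd-proj r⦂A∧C , A≡B = A≡B , _ , ty-≡ r⦂A∧C (≡-cong∧ A≡B ≡-refl)

open Generation
open VarSystem using (_∈V_)

mainTheorem6 : (𝒱 : VarSystem) →
    (∀ {x A B} → _∈V_ 𝒱 x A → _∶_ 𝒱 (var x) B → A ≡ₜ B)
    × (∀ {x r A B} → _∈V_ 𝒱 x A → _∶_ 𝒱 (lam x r) B
        → ∃[ C ] (B ≡ₜ A ⇒ C × _∶_ 𝒱 r C))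
    × (∀ {r s B} → _∶_ 𝒱 (app r s) B → ∃[ A ] (_∶_ 𝒱 r (A ⇒ B) × _∶_ 𝒱 s A))
    × (∀ {r s A} → _∶_ 𝒱 (pair r s) A
        → ∃[ B ] ∃[ C ] (A ≡ₜ B ∧ C × _∶_ 𝒱 r B × _∶_ 𝒱 s C))
    × (∀ {r A B} → _∶_ 𝒱 (proj A r) B → A ≡ₜ B × ∃[ C ] (_∶_ 𝒱 r (B ∧ C)))
mainTheorem6 𝒱 =
  varGeneration 𝒱 , lamGeneration 𝒱 , appGeneration 𝒱 ,
  pairGeneration 𝒱 , projGeneration 𝒱
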